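{- Let $a\in\mathbb{N}$, let $2 \leq k < a+1$, and let $M$ be a strong $k$-chromatic-choosable graph with vertex set $\{v_1,\dots,v_n\}$. Let $H = M \square K_{a,1}$, where $K_{a,1}$ has partite sets $\{u_1,\dots,u_a\}$ and $\{w_1\}$. Let $L$ be a $(k+a-1)$-assignment for $H$ such that for each $i\in[n]$ the lists $L(v_i,u_1), \dots, L(v_i,u_a)$ are pairwise disjoint. Let $\mathcal{B}$ be the set of proper $L$-colorings of $H[\bigcup_{j=1}^a V_{u_j}]$ that are bad for the copy of $M$ corresponding to $w_1$. Then $|\mathcal{B}| \leq 2^{k-1}$.
   Context: All graphs are finite, simple and nonempty; $[k]=\{1,\dots,k\}$. A list assignment $L$ assigns to each vertex $v$ a set $L(v)$ of colors; a proper $L$-coloring is a proper coloring $c$ with $c(v)\in L(v)$ for all $v$; the graph is $L$-colorable if one exists. $L$ is a $k$-assignment if $|L(v)|=k$ for all $v$, and is constant if all lists are equal. A graph $G$ is strong $k$-chromatic-choosable if $\chi(G)=k$ and every $(k-1)$-assignment $L$ for which $G$ is not $L$-colorable is constant. The Cartesian product $M \square K$ has vertex set $V(M)\times V(K)$, with $(u,v)$ adjacent to $(u',v')$ iff either $u=u'$ and $vv'\in E(K)$, or $v=v'$ and $uu'\in E(M)$. For $u\in V(K_{a,1})$, $V_u$ is the set of vertices of $H$ with second coordinate $u$, and $H[V_u]$ is called the copy of $M$ corresponding to $u$. A proper $L$-coloring $f$ of $H[\bigcup_{j=1}^a V_{u_j}]$ is bad for the copy of $M$ corresponding to $w_1$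 if there is no proper $L'$-coloring of $H[V_{w_1}]$, where $L'(v_i,w_1) = L(v_i,w_1)\setminus\{f(v_i,u_j): j\in[a]\}$ for each $i\in[n]$. -}

module Defs where

open import Data.Nat using (ℕ; zero; suc; _+_; _∸_; _^_; _≤_; _<_)
open import Data.Fin using (Fin)
open import Data.Unit using (⊤; tt)
open import Data.Sum using (_⊎_; inj₁; inj₂)
open import Data.Product using (Σ; _×_; _,_; proj₁; proj₂; ∃)
open import Data.Empty using (⊥)
open import Data.List using (List; length)
open import Data.List.Membership.Propositional using (_∈_; _∉_)
open import Data.List.Relation.Unary.Unique.Propositional using (Unique)
open import Data.List.Relation.Unary.All using (All)
open import Data.List.Relation.Unary.AllPairs using (AllPairs)
open import Relation.Nullary using (¬_)
open import Relation.Binary.PropositionalEquality using (_≡_; _≢_)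

record Graph (V : Set) : Set₁ where
  field
    Adj     : V → V → Set
    sym     : ∀ {x y} → Adj x y → Adj y x
    irrefl  : ∀ {x} → ¬ Adj x x
open Graph public

-- Colors are natural numbers.  A list of colors is a finite set (lists are duplicate-free
-- whenever they represent an assignment).
Color : Set
Color = ℕ

ProperColoring : {V C : Set} → Graph V → (V → C) → Set
ProperColoring G c = ∀ x y → Adj G x y → c x ≢ c y

Colorable : {V : Set} → Graph V → ℕ → Set
Colorable G m = Σ (_ → Fin m) λ c → ProperColoring G c

ChromaticNumber≡ : {V : Set} → Graph V → ℕ → Set
ChromaticNumber≡ G k = Colorable G k × ¬ Colorable G (k ∸ 1)

ListAssignment : Set → Set
ListAssignment V = V → List Color

IsKAssignment : {V : Set} → ℕ → ListAssignment V → Set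
IsKAssignment k L = ∀ v → Unique (L v) × length (L v) ≡ k

IsConstant : {V : Set} → ListAssignment V → Set
IsConstant L = ∀ u v (x : Color) → (x ∈ L u → x ∈ L v) × (x ∈ L v → x ∈ L u)

LColorable : {V : Set} → Graph V → ListAssignment V → Set
LColorable G L = Σ (_ → Color) λ c → ProperColoring G c × (∀ v → c v ∈ L v)

StrongChromaticChoosable : {V : Set} → Graph V → ℕ → Set
StrongChromaticChoosable G k =
  ChromaticNumber≡ G k ×
  (∀ (L : ListAssignment _) → IsKAssignment (k ∸ 1) L → ¬ LColorable G L → IsConstant L)

_□_ : {V W : Set} → Graph V → Graph W → Graph (V × W)
Adj (_□_ M K) (u , v) (u' , v') = (u ≡ u' × Adj K v v') ⊎ (v ≡ v' × Adj M u u')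
sym (_□_ M K) (inj₁ (Relation.Binary.PropositionalEquality.refl , e)) =
  inj₁ (Relation.Binary.PropositionalEquality.refl , sym K e)
sym (_□_ M K) (inj₂ (Relation.Binary.PropositionalEquality.refl , e)) =
  inj₂ (Relation.Binary.PropositionalEquality.refl , sym M e)
irrefl (_□_ M K) (inj₁ (_ , e)) = irrefl K e
irrefl (_□_ M K) (inj₂ (_ , e)) = irrefl M e

-- K_{a,1}: vertices inj₁ j (= u_{j+1}, j : Fin a) and inj₂ tt (= w_1).
KAdj : (a : ℕ) → Fin a ⊎ ⊤ → Fin a ⊎ ⊤ → Set
KAdj a (inj₁ _) (inj₁ _) = ⊥
KAdj a (inj₁ _) (inj₂ _) = ⊤
KAdj a (inj₂ _) (inj₁ _) = ⊤
KAdj a (inj₂ _) (inj₂ _) = ⊥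

K[_,1] : (a : ℕ) → Graph (Fin a ⊎ ⊤)
Adj K[ a ,1] = KAdj a
sym K[ a ,1] {inj₁ _} {inj₂ _} _ = tt
sym K[ a ,1] {inj₂ _} {inj₁ _} _ = tt
irrefl K[ a ,1] {inj₁ _} ()
irrefl K[ a ,1] {inj₂ _} ()

w₁ : {a : ℕ} → Fin a ⊎ ⊤
w₁ = inj₂ tt

-- Induced subgraph H[S] for a vertex predicate S; its vertices are Σ V S.
InducedProper : {V : Set} → Graph V → (S : V → Set) → (Σ V S → Color) → Set
InducedProper G S c = ∀ (x y : Σ V S) → Adj G (proj₁ x) (proj₁ y) → c x ≢ c y
  where V = _

H : {n : ℕ} → (a : ℕ) → Graph (Fin n) → Graph (Fin n × (Fin a ⊎ ⊤))
H a M = M □ K[ a ,1]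

InU : {n a : ℕ} → Fin n × (Fin a ⊎ ⊤) → Set
InU {n} {a} x = Σ (Fin a) λ j → proj₂ x ≡ inj₁ j

InW : {n a : ℕ} → Fin n × (Fin a ⊎ ⊤) → Set
InW x = proj₂ x ≡ inj₂ tt

ULColoring : {n : ℕ} (a : ℕ) → Graph (Fin n) → ListAssignment (Fin n × (Fin a ⊎ ⊤))
           → (Σ (Fin n × (Fin a ⊎ ⊤)) InU → Color) → Set
ULColoring a M L f = InducedProper (H a M) InU f × (∀ x → f x ∈ L (proj₁ x))

-- f is bad for the copy of M corresponding to w₁: no proper L'-coloring of H[V_{w₁}],
-- where L'(v_i,w₁) = L(v_i,w₁) \ {f(v_i,u_j) : j ∈ [a]}.
Bad : {n : ℕ} (a : ℕ) → Graph (Fin n) → ListAssignment (Fin n × (Fin a ⊎ ⊤))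
    → (Σ (Fin n × (Fin a ⊎ ⊤)) InU → Color) → Set
Bad {n} a M L f =
  ¬ (Σ (Σ (Fin n × (Fin a ⊎ ⊤)) InW → Color) λ c →
       InducedProper (H a M) InW c ×
       (∀ (x : Σ (Fin n × (Fin a ⊎ ⊤)) InW) →
          c x ∈ L (proj₁ x) ×
          (∀ (j : Fin a) → c x ≢ f ((proj₁ (proj₁ x) , inj₁ j) , j , Relation.Binary.PropositionalEquality.refl))))

Differ : {n a : ℕ} → (f g : Σ (Fin n × (Fin a ⊎ ⊤)) InU → Color) → Set
Differ f g = ∃ λ x → f x ≢ g x

-- |B| ≤ N : every duplicate-free list of elements of B has length ≤ N
CardBadAtMost : {n : ℕ} (a : ℕ) → Graph (Fin n) → ListAssignment (Fin n × (Fin a ⊎ ⊤)) → ℕ → Set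
CardBadAtMost {n} a M L N =
  ∀ (fs : List (Σ (Fin n × (Fin a ⊎ ⊤)) InU → Color)) →
    All (λ f → ULColoring a M L f × Bad a M L f) fs →
    AllPairs Differ fs →
    length fs ≤ N

-- For a coloring f in 𝓑 and a vertex v of M, let R_f(v) be L(v,w₁) minus the a colors f uses on
-- (v,u₁),…,(v,u_a). Every R_f(v) has at least k − 1 colors and M is not R_f-colorable, so strong
-- chromatic-choosability forces R_f to be a constant (k − 1)-assignment; counting then shows that
-- f(v,u_j) ∈ L(v,w₁) for all v, j. Hence f is determined by its values at one vertex v₀: a color
-- f(v,u_j) not used by g at v lies in R_g(v) = R_g(v₀) = R_f(v₀) = R_f(v), which avoids f's colors,
-- and if g(v,u_j′) = f(v,u_j) then j′ = j by disjointness. The values f(v₀,u_j) lie in the pairwise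
-- disjoint sets A_j = L(v₀,w₁) ∩ L(v₀,u_j), nonempty when 𝓑 is, with Σ|A_j| ≤ k − 1 + a, so
-- |𝓑| ≤ ∏|A_j| ≤ 2^Σ(|A_j| − 1) ≤ 2^(k − 1).

module Submission where

open import Defs hiding (sym)
open import Data.Nat using (ℕ; zero; suc; _+_; _*_; _∸_; _^_; _≤_; _<_; s≤s; s≤s⁻¹; z≤n; _≤?_)
open import Data.Nat.Properties hiding (_≟_)
import Data.Nat.Properties as ℕ
open import Data.Fin using (Fin; zero; suc; fromℕ<)
import Data.Fin.Properties as Fin
open import Data.Unit using (⊤)
open import Data.Sum using (_⊎_; inj₁; inj₂)
open import Data.Product using (Σ; ∃; _×_; _,_; proj₁; proj₂)
open import Data.Empty using (⊥-elim)
open import Data.Vec.Functional using (Vector; head; tail; updateAt)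
open import Data.Vec.Functional.Properties using (updateAt-updates; updateAt-minimal)
open import Data.List using (List; []; _∷_; length; filter; take; map; tabulate)
open import Data.List.Properties
  using (length-removeAt′; length-filter; filter-notAll; length-take; length-map; length-tabulate; tabulate-cong)
open import Data.List.Membership.Propositional using (_∈_; _∉_; _─_)
open import Data.List.Membership.Propositional.Properties using (∈-filter⁺; ∈-filter⁻; ∈-tabulate⁺; ∈-tabulate⁻)
open import Data.List.Relation.Unary.Any using (here; there)
import Data.List.Relation.Unary.Any as Any
open import Data.List.Relation.Unary.All using (All; []; _∷_)
import Data.List.Relation.Unary.All as All
import Data.List.Relation.Unary.All.Properties as All
open import Data.List.Relation.Unary.AllPairs using (AllPairs; []; _∷_)
import Data.List.Relation.Unary.AllPairs as AllPairs
import Data.List.Relation.Unary.AllPairs.Properties as AllPairs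
open import Data.List.Relation.Unary.Unique.Propositional using (Unique)
import Data.List.Relation.Unary.Unique.Propositional.Properties as Unique
open import Data.List.Relation.Binary.Subset.Propositional using (_⊆_)
import Data.List.Relation.Binary.Sublist.Propositional.Properties as Sublist
open import Function using (_∘_; id)
open import Relation.Nullary using (¬_; Dec; yes; no)
open import Relation.Unary using (Decidable)
open import Relation.Unary.Properties using (∁?)
open import Relation.Binary.Definitions using (DecidableEquality)
open import Relation.Binary.PropositionalEquality
open import Algebra.Properties.Monoid.Sum +-0-monoid using (sum; sum-cong-≗)
open import Algebra.Definitions.RawMonoid *-1-rawMonoid using () renaming (sum to ∏)

module _ {A : Set} where

  ∈⇒1≤length : ∀ {x : A} {xs} → x ∈ xs → 1 ≤ length xs
  ∈⇒1≤length (here _) = s≤s z≤n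
  ∈⇒1≤length (there _) = s≤s z≤n

  head∈take : ∀ {m} {x : A} {xs} → 1 ≤ m → x ∈ take m (x ∷ xs)
  head∈take {m = suc _} _ = here refl

  ∈-─⁺ : ∀ {x y : A} {ys} (p : y ∈ ys) → x ∈ ys → x ≢ y → x ∈ ys ─ p
  ∈-─⁺ (here refl) (here refl) x≢y = ⊥-elim (x≢y refl)
  ∈-─⁺ (here refl) (there q) _ = q
  ∈-─⁺ (there p) (here refl) _ = here refl
  ∈-─⁺ (there p) (there q) x≢y = there (∈-─⁺ p q x≢y)

  unique-⊆⇒length≤ : ∀ {xs ys : List A} → Unique xs → xs ⊆ ys → length xs ≤ length ys
  unique-⊆⇒length≤ {[]} _ _ = z≤n
  unique-⊆⇒length≤ {x ∷ xs} {ys} (x∉xs ∷ u) xs⊆ys = begin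
    suc (length xs)          ≤⟨ s≤s (unique-⊆⇒length≤ u xs⊆ys─x) ⟩
    suc (length (ys ─ x∈ys)) ≡⟨ length-removeAt′ ys _ ⟨
    length ys                ∎
    where
    open ≤-Reasoning
    x∈ys = xs⊆ys (here refl)
    xs⊆ys─x : xs ⊆ ys ─ x∈ys
    xs⊆ys─x z∈xs = ∈-─⁺ x∈ys (xs⊆ys (there z∈xs)) λ { refl → All.lookup x∉xs z∈xs refl }

  length-filter+length-filter-∁ : ∀ {P : A → Set} (P? : Decidable P) xs →
    length (filter P? xs) + length (filter (∁? P?) xs) ≡ length xs
  length-filter+length-filter-∁ P? [] = refl
  length-filter+length-filter-∁ P? (x ∷ xs) with P? x
  ... | yes _ = cong suc (length-filter+length-filter-∁ P? xs)
  ... | no _ = trans (+-suc _ _) (cong suc (length-filter+length-filter-∁ P? xs))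

  filter-absorbs : ∀ {P Q : A → Set} (P? : Decidable P) (Q? : Decidable Q) →
    (∀ {x} → P x → Q x) → ∀ xs → filter P? (filter Q? xs) ≡ filter P? xs
  filter-absorbs P? Q? P⇒Q [] = refl
  filter-absorbs P? Q? P⇒Q (x ∷ xs) with Q? x
  ... | yes _ with P? x
  ...   | yes _ = cong (x ∷_) (filter-absorbs P? Q? P⇒Q xs)
  ...   | no _  = filter-absorbs P? Q? P⇒Q xs
  filter-absorbs P? Q? P⇒Q (x ∷ xs) | no ¬q with P? x
  ...   | yes p = ⊥-elim (¬q (P⇒Q p))
  ...   | no _  = filter-absorbs P? Q? P⇒Q xs

module _ {A : Set} (_≟_ : DecidableEquality A) where
  open import Data.List.Membership.DecPropositional _≟_ using (_∈?_)

  private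
    length-filter-∈-swap : ∀ {xs} ys → Unique xs →
      length (filter (_∈? ys) xs) ≤ length (filter (_∈? xs) ys)
    length-filter-∈-swap {xs} ys u = unique-⊆⇒length≤ (Unique.filter⁺ (_∈? ys) u) λ z∈ →
      let z∈xs , z∈ys = ∈-filter⁻ (_∈? ys) {xs = xs} z∈ in ∈-filter⁺ (_∈? xs) z∈ys z∈xs

  length-filter-∈≤ : ∀ {xs} ys → Unique xs → length (filter (_∈? ys) xs) ≤ length ys
  length-filter-∈≤ ys u = ≤-trans (length-filter-∈-swap ys u) (length-filter (_∈? _) ys)

  length-filter-∈< : ∀ {xs ys y} → Unique xs → y ∈ ys → y ∉ xs →
    length (filter (_∈? ys) xs) < length ys
  length-filter-∈< {ys = ys} u y∈ys y∉xs = ≤-<-trans (length-filter-∈-swap ys u)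
    (filter-notAll (_∈? _) ys (Any.map (λ { refl → y∉xs }) y∈ys))

module _ {A : Set} {P : A → Set} {R : A → A → Set} where

  all⇒allPairs : (∀ {x y} → P x → P y → R x y) → ∀ {xs} → All P xs → AllPairs R xs
  all⇒allPairs P⇒R [] = []
  all⇒allPairs P⇒R (px ∷ pxs) = All.map (P⇒R px) pxs ∷ all⇒allPairs P⇒R pxs

module _ {B C : Set} (_≟_ : DecidableEquality C) (κ : B → C) where

  fibre : C → List B → List B
  fibre c = filter (λ x → κ x ≟ c)

  length≤length*fibre : ∀ cs xs {b} → All (λ x → κ x ∈ cs) xs →
    (∀ c → length (fibre c xs) ≤ b) → length xs ≤ length cs * b
  length≤length*fibre [] [] _ _ = z≤n
  length≤length*fibre [] (_ ∷ _) (() ∷ _) _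
  length≤length*fibre (c ∷ cs) xs {b} keys fibre≤b = begin
    length xs                         ≡⟨ length-filter+length-filter-∁ (λ x → κ x ≟ c) xs ⟨
    length (fibre c xs) + length rest
      ≤⟨ +-mono-≤ (fibre≤b c) (length≤length*fibre cs rest rest-keys rest-fibre≤b) ⟩
    b + length cs * b                 ∎
    where
    open ≤-Reasoning
    rest = filter (∁? (λ x → κ x ≟ c)) xs
    rest-keys : All (λ x → κ x ∈ cs) rest
    rest-keys = All.zipWith (λ { (here κx≡c , κx≢c) → ⊥-elim (κx≢c κx≡c)
                               ; (there κx∈cs , _) → κx∈cs })
                            (All.filter⁺ _ keys , All.all-filter _ xs)
    rest-fibre≤b : ∀ c′ → length (fibre c′ rest) ≤ b
    rest-fibre≤b c′ = ≤-trans (Sublist.length-mono-≤ fibre-rest⊆fibre) (fibre≤b c′)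
      where fibre-rest⊆fibre = Sublist.filter⁺ _ _ (λ { refl p → p }) (Sublist.filter-⊆ _ xs)

Distinct : {A B : Set} → (A → B) → (A → B) → Set
Distinct g h = ∃ λ x → g x ≢ h x

distinct-tail : ∀ {a} {C : Set} {g h : Fin (suc a) → C} →
  Distinct g h → head g ≡ head h → Distinct (tail g) (tail h)
distinct-tail (zero , g≢h) g≡h = ⊥-elim (g≢h g≡h)
distinct-tail (suc j , g≢h) _ = j , g≢h

module _ {C : Set} (_≟_ : DecidableEquality C) where

  length≤∏ : ∀ {a} (A : Fin a → List C) gs → All (λ g → ∀ j → g j ∈ A j) gs → AllPairs Distinct gs →
    length gs ≤ ∏ (λ j → length (A j))
  length≤∏ {zero} A [] _ _ = z≤n
  length≤∏ {zero} A (_ ∷ []) _ _ = ≤-refl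
  length≤∏ {zero} A (_ ∷ _ ∷ _) _ (((() , _) ∷ _) ∷ _)
  length≤∏ {suc a} A gs gs∈A gs-distinct =
    length≤length*fibre _≟_ head (A zero) gs (All.map (λ g∈A → g∈A zero) gs∈A) fibre-bound
    where
    fibre-bound : ∀ c → length (fibre _≟_ head c gs) ≤ ∏ (λ j → length (A (suc j)))
    fibre-bound c = begin
      length (fibre _≟_ head c gs)            ≡⟨ length-map tail (fibre _≟_ head c gs) ⟨
      length (map tail (fibre _≟_ head c gs)) ≤⟨ length≤∏ (A ∘ suc) _ tails∈A tails-distinct ⟩
      ∏ (λ j → length (A (suc j)))             ∎
      where
      open ≤-Reasoning
      tails∈A = All.map⁺ (All.map (λ g∈A j → g∈A (suc j)) (All.filter⁺ _ gs∈A))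
      same-head = all⇒allPairs (λ g≡c h≡c → trans g≡c (sym h≡c)) (All.all-filter _ gs)
      tails-distinct = AllPairs.map⁺ (AllPairs.zipWith (λ (g≠h , g≡h) → distinct-tail g≠h g≡h)
                                                       (AllPairs.filter⁺ _ gs-distinct , same-head))

m≤2^[m∸1] : ∀ m → m ≤ 2 ^ (m ∸ 1)
m≤2^[m∸1] zero = z≤n
m≤2^[m∸1] (suc zero) = ≤-refl
m≤2^[m∸1] (suc (suc t)) = begin
  1 + suc t       ≤⟨ +-mono-≤ (m^n>0 2 t) (m≤2^[m∸1] (suc t)) ⟩
  2 ^ t + 2 ^ t   ≡⟨ cong (2 ^ t +_) (+-identityʳ (2 ^ t)) ⟨
  2 ^ suc t       ∎
  where open ≤-Reasoning

∏≤2^∑[∸1] : ∀ {a} (m : Fin a → ℕ) → ∏ m ≤ 2 ^ sum (λ j → m j ∸ 1)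
∏≤2^∑[∸1] {zero} m = ≤-refl
∏≤2^∑[∸1] {suc a} m = begin
  m zero * ∏ (m ∘ suc)
    ≤⟨ *-mono-≤ (m≤2^[m∸1] (m zero)) (∏≤2^∑[∸1] (m ∘ suc)) ⟩
  2 ^ (m zero ∸ 1) * 2 ^ sum (λ j → m (suc j) ∸ 1)
    ≡⟨ ^-distribˡ-+-* 2 (m zero ∸ 1) _ ⟨
  2 ^ sum (λ j → m j ∸ 1) ∎
  where open ≤-Reasoning

∑[∸1]+a≡∑ : ∀ {a} (m : Fin a → ℕ) → (∀ j → 1 ≤ m j) → sum (λ j → m j ∸ 1) + a ≡ sum m
∑[∸1]+a≡∑ {zero} m _ = refl
∑[∸1]+a≡∑ {suc a} m m≥1 = begin
  (m zero ∸ 1 + s) + suc a   ≡⟨ +-suc _ a ⟩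
  suc ((m zero ∸ 1 + s) + a) ≡⟨ cong suc (+-assoc (m zero ∸ 1) s a) ⟩
  suc (m zero ∸ 1) + (s + a) ≡⟨ cong₂ _+_ (trans (+-comm 1 _) (m∸n+n≡m (m≥1 zero)))
                                         (∑[∸1]+a≡∑ (m ∘ suc) (m≥1 ∘ suc)) ⟩
  m zero + sum (m ∘ suc)     ∎
  where
  open ≡-Reasoning
  s = sum (λ j → m (suc j) ∸ 1)

∑≤s+a⇒∏≤2^s : ∀ {a s} (m : Fin a → ℕ) → (∀ j → 1 ≤ m j) → sum m ≤ s + a → ∏ m ≤ 2 ^ s
∑≤s+a⇒∏≤2^s {a} {s} m m≥1 ∑m≤s+a =
  ≤-trans (∏≤2^∑[∸1] m) (^-monoʳ-≤ 2 (+-cancelʳ-≤ a _ s (begin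
    sum (λ j → m j ∸ 1) + a ≡⟨ ∑[∸1]+a≡∑ m m≥1 ⟩
    sum m                   ≤⟨ ∑m≤s+a ⟩
    s + a                   ∎)))
  where open ≤-Reasoning

∑-length-filter-disjoint : ∀ {A : Set} {a} {P : Fin a → A → Set} (P? : ∀ j → Decidable (P j)) →
  (∀ {j j′ x} → P j x → P j′ x → j ≡ j′) →
  ∀ xs → sum (λ j → length (filter (P? j) xs)) ≤ length xs
∑-length-filter-disjoint {a = zero} P? disjoint xs = z≤n
∑-length-filter-disjoint {a = suc a} P? disjoint xs = begin
  length (filter (P? zero) xs) + sum (λ j → length (filter (P? (suc j)) xs))
    ≡⟨ cong (length (filter (P? zero) xs) +_) (sum-cong-≗ (cong length ∘ filtered-rest)) ⟨
  length (filter (P? zero) xs) + sum (λ j → length (filter (P? (suc j)) rest))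
    ≤⟨ +-monoʳ-≤ _ (∑-length-filter-disjoint (P? ∘ suc) (λ p q → Fin.suc-injective (disjoint p q)) rest) ⟩
  length (filter (P? zero) xs) + length rest
    ≡⟨ length-filter+length-filter-∁ (P? zero) xs ⟩
  length xs ∎
  where
  open ≤-Reasoning
  rest = filter (∁? (P? zero)) xs
  filtered-rest : ∀ j → filter (P? (suc j)) rest ≡ filter (P? (suc j)) xs
  filtered-rest j = filter-absorbs (P? (suc j)) (∁? (P? zero)) (λ p p₀ → Fin.0≢1+n (disjoint p₀ p)) xs

LColorable-⊆ : ∀ {V : Set} (G : Graph V) {L₁ L₂ : ListAssignment V} →
  (∀ v → L₁ v ⊆ L₂ v) → LColorable G L₁ → LColorable G L₂
LColorable-⊆ G L₁⊆L₂ (c , proper , c∈L₁) = c , proper , λ v → L₁⊆L₂ v (c∈L₁ v)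

updateAt-pointwise : ∀ {n} {A : Set} {P : Fin n → A → Set} (xs : Vector A n) i {f : A → A} →
  P i (f (xs i)) → (∀ j → P j (xs j)) → ∀ j → P j (updateAt xs i f j)
updateAt-pointwise {P = P} xs i Pi Pxs j with j Fin.≟ i
... | yes refl = subst (P i) (sym (updateAt-updates i xs)) Pi
... | no j≢i = subst (P j) (sym (updateAt-minimal j i xs j≢i)) (Pxs j)

vertex-of-uncolorable : ∀ {n m} (M : Graph (Fin n)) → ¬ Colorable M m → Fin n
vertex-of-uncolorable {zero} M ¬col = ⊥-elim (¬col ((λ ()) , λ ()))
vertex-of-uncolorable {suc n} M ¬col = zero

another-vertex : ∀ {n m} (M : Graph (Fin n)) → 1 ≤ m → ¬ Colorable M m → (i : Fin n) → ∃ λ i′ → i′ ≢ i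
another-vertex {suc zero} M 1≤m ¬col zero =
  ⊥-elim (¬col ((λ _ → fromℕ< 1≤m) , λ { zero zero adj _ → irrefl M adj }))
another-vertex {suc (suc n)} M _ _ zero = suc zero , λ ()
another-vertex {suc (suc n)} M _ _ (suc i) = zero , λ ()

module StrongChoosability {n k} (M : Graph (Fin n)) (scc : StrongChromaticChoosable M k) (2≤k : 2 ≤ k) where

  1≤k∸1 : 1 ≤ k ∸ 1
  1≤k∸1 = ∸-monoˡ-≤ 1 2≤k

  not-[k∸1]-colorable : ¬ Colorable M (k ∸ 1)
  not-[k∸1]-colorable = proj₂ (proj₁ scc)

  Long : ListAssignment (Fin n) → Set
  Long L = ∀ i → Unique (L i) × k ∸ 1 ≤ length (L i)

  truncate : ListAssignment (Fin n) → ListAssignment (Fin n)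
  truncate L i = take (k ∸ 1) (L i)

  truncate-constant : ∀ L → Long L → ¬ LColorable M L → IsConstant (truncate L)
  truncate-constant L long ¬col =
    proj₂ scc (truncate L) truncate-assignment (¬col ∘ LColorable-⊆ M truncate-⊆)
    where
    truncate-assignment : IsKAssignment (k ∸ 1) (truncate L)
    truncate-assignment i =
      Unique.take⁺ _ (proj₁ (long i)) , trans (length-take _ (L i)) (m≤n⇒m⊓n≡m (proj₂ (long i)))
    truncate-⊆ : ∀ i → truncate L i ⊆ L i
    truncate-⊆ i = Sublist.Any-resp-⊆ (Sublist.take-⊆ _ (L i))

  -- Truncating L, and L with x dropped at i, to k ∸ 1 colors gives two constant assignments:
  -- the first carries x from i to another vertex i′, the second carries it back into xs.
  ¬long-tail : ∀ L → Long L → ¬ LColorable M L → ∀ i {x xs} → L i ≡ x ∷ xs → ¬ (k ∸ 1 ≤ length xs)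
  ¬long-tail L long ¬col i {x} {xs} L[i]≡x∷xs k∸1≤|xs| =
    All.lookup (AllPairs.head x∷xs-unique) x∈xs refl
    where
    x∷xs-unique : Unique (x ∷ xs)
    x∷xs-unique = subst Unique L[i]≡x∷xs (proj₁ (long i))
    L′ : ListAssignment (Fin n)
    L′ = updateAt L i (λ _ → xs)
    L′-long-⊆L : ∀ j → (Unique (L′ j) × k ∸ 1 ≤ length (L′ j)) × L′ j ⊆ L j
    L′-long-⊆L = updateAt-pointwise {P = λ j l → (Unique l × k ∸ 1 ≤ length l) × l ⊆ L j} L i
      ((AllPairs.tail x∷xs-unique , k∸1≤|xs|) , λ z∈xs → subst (_ ∈_) (sym L[i]≡x∷xs) (there z∈xs))
      (λ j → long j , id)
    L′-constant : IsConstant (truncate L′)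
    L′-constant = truncate-constant L′ (proj₁ ∘ L′-long-⊆L) (¬col ∘ LColorable-⊆ M (proj₂ ∘ L′-long-⊆L))
    i′ = proj₁ (another-vertex M 1≤k∸1 not-[k∸1]-colorable i)
    i′≢i = proj₂ (another-vertex M 1≤k∸1 not-[k∸1]-colorable i)
    x∈L[i]ᵗ : x ∈ truncate L i
    x∈L[i]ᵗ = subst (λ l → x ∈ take (k ∸ 1) l) (sym L[i]≡x∷xs) (head∈take 1≤k∸1)
    x∈L′[i′]ᵗ : x ∈ truncate L′ i′
    x∈L′[i′]ᵗ = subst (λ l → x ∈ take (k ∸ 1) l) (sym (updateAt-minimal i′ i L i′≢i))
                  (proj₁ (truncate-constant L long ¬col i i′ x) x∈L[i]ᵗ)
    x∈L′[i]ᵗ : x ∈ truncate L′ i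
    x∈L′[i]ᵗ = proj₁ (L′-constant i′ i x) x∈L′[i′]ᵗ
    x∈xs : x ∈ xs
    x∈xs = Sublist.Any-resp-⊆ (Sublist.take-⊆ (k ∸ 1) xs)
             (subst (λ l → x ∈ take (k ∸ 1) l) (updateAt-updates i L) x∈L′[i]ᵗ)

  uncolorable⇒length≤ : ∀ L → Long L → ¬ LColorable M L → ∀ i → length (L i) ≤ k ∸ 1
  uncolorable⇒length≤ L long ¬col i with L i in L[i]≡
  ... | [] = z≤n
  ... | x ∷ xs with suc (length xs) ≤? k ∸ 1
  ...   | yes |x∷xs|≤k∸1 = |x∷xs|≤k∸1
  ...   | no |x∷xs|≰k∸1 = ⊥-elim (¬long-tail L long ¬col i L[i]≡ (s≤s⁻¹ (≰⇒> |x∷xs|≰k∸1)))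

  uncolorable⇒constant : ∀ L → Long L → ¬ LColorable M L → IsConstant L
  uncolorable⇒constant L long ¬col = proj₂ scc L
    (λ i → proj₁ (long i) , ≤-antisym (uncolorable⇒length≤ L long ¬col i) (proj₂ (long i))) ¬col

open import Data.List.Membership.DecPropositional ℕ._≟_ using (_∈?_; _∉?_)

module Residual {n} (a : ℕ) (M : Graph (Fin n)) (L : ListAssignment (Fin n × (Fin a ⊎ ⊤))) where

  Coloring : Set
  Coloring = Σ (Fin n × (Fin a ⊎ ⊤)) InU → Color

  colorAt : Coloring → Fin n → Fin a → Color
  colorAt f i j = f ((i , inj₁ j) , j , refl)

  forbidden : Coloring → Fin n → List Color
  forbidden f i = tabulate (colorAt f i)

  residual : Coloring → ListAssignment (Fin n)
  residual f i = filter (_∉? forbidden f i) (L (i , w₁))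

  bad⇒residual-uncolorable : ∀ f → Bad a M L f → ¬ LColorable M (residual f)
  bad⇒residual-uncolorable f bad (c , c-proper , c∈residual) = bad (c′ , c′-proper , c′-allowed)
    where
    c′ : Σ (Fin n × (Fin a ⊎ ⊤)) InW → Color
    c′ ((i , _) , _) = c i
    c′-proper : InducedProper (H a M) InW c′
    c′-proper ((i , _) , refl) ((i′ , _) , refl) (inj₂ (_ , adj)) = c-proper i i′ adj
    c′-allowed : ∀ x → c′ x ∈ L (proj₁ x) × (∀ j → c′ x ≢ colorAt f (proj₁ (proj₁ x)) j)
    c′-allowed ((i , _) , refl) with ∈-filter⁻ (_∉? forbidden f i) (c∈residual i)
    ... | c∈L , c∉forbidden =
      c∈L , λ j c≡f → c∉forbidden (subst (_∈ forbidden f i) (sym c≡f) (∈-tabulate⁺ j))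

module BadColorings (a k n : ℕ) (2≤k : 2 ≤ k) (M : Graph (Fin n)) (scc : StrongChromaticChoosable M k)
  (L : ListAssignment (Fin n × (Fin a ⊎ ⊤))) (L-size : IsKAssignment (k + a ∸ 1) L)
  (disjoint : ∀ (i : Fin n) (j j′ : Fin a) → j ≢ j′ → ∀ (x : Color) →
     x ∈ L (i , inj₁ j) → x ∉ L (i , inj₁ j′)) where

  open Residual a M L
  open StrongChoosability M scc 2≤k

  Lw : ListAssignment (Fin n)
  Lw i = L (i , w₁)

  length-Lw : ∀ i → length (Lw i) ≡ k ∸ 1 + a
  length-Lw i = trans (proj₂ (L-size (i , w₁))) (+-∸-comm a (≤-trans (s≤s z≤n) 2≤k))

  length-forbidden : ∀ f i → length (forbidden f i) ≡ a
  length-forbidden f i = length-tabulate (colorAt f i)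

  residual-long : ∀ f → Long (residual f)
  residual-long f i = Unique.filter⁺ _ (proj₁ (L-size (i , w₁))) , +-cancelʳ-≤ a _ _ (begin
    k ∸ 1 + a                                                 ≡⟨ length-Lw i ⟨
    length (Lw i)
      ≡⟨ length-filter+length-filter-∁ (_∈? forbidden f i) (Lw i) ⟨
    length (filter (_∈? forbidden f i) (Lw i)) + length (residual f i)
      ≤⟨ +-monoˡ-≤ _ (length-filter-∈≤ ℕ._≟_ (forbidden f i) (proj₁ (L-size (i , w₁)))) ⟩
    length (forbidden f i) + length (residual f i)
      ≡⟨ cong (_+ length (residual f i)) (length-forbidden f i) ⟩
    a + length (residual f i)                                 ≡⟨ +-comm a _ ⟩
    length (residual f i) + a                                 ∎)
    where open ≤-Reasoning

  bad⇒residual-constant : ∀ f → Bad a M L f → IsConstant (residual f)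
  bad⇒residual-constant f bad =
    uncolorable⇒constant (residual f) (residual-long f) (bad⇒residual-uncolorable f bad)

  bad⇒colorAt∈Lw : ∀ f → Bad a M L f → ∀ i j → colorAt f i j ∈ Lw i
  bad⇒colorAt∈Lw f bad i j with colorAt f i j ∈? Lw i
  ... | yes y∈Lw = y∈Lw
  ... | no y∉Lw = ⊥-elim (<-irrefl (length-Lw i) (begin-strict
    length (Lw i)
      ≡⟨ length-filter+length-filter-∁ (_∈? forbidden f i) (Lw i) ⟨
    length (filter (_∈? forbidden f i) (Lw i)) + length (residual f i)
      <⟨ +-mono-<-≤ (length-filter-∈< ℕ._≟_ (proj₁ (L-size (i , w₁))) (∈-tabulate⁺ j) y∉Lw)
                    (uncolorable⇒length≤ (residual f) (residual-long f) (bad⇒residual-uncolorable f bad) i) ⟩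
    length (forbidden f i) + (k ∸ 1)                          ≡⟨ cong (_+ (k ∸ 1)) (length-forbidden f i) ⟩
    a + (k ∸ 1)                                               ≡⟨ +-comm a _ ⟩
    k ∸ 1 + a                                                 ∎))
    where open ≤-Reasoning

  InB : Coloring → Set
  InB f = ULColoring a M L f × Bad a M L f

  colorAt∈L : ∀ f → ULColoring a M L f → ∀ i j → colorAt f i j ∈ L (i , inj₁ j)
  colorAt∈L f (_ , f∈L) i j = f∈L ((i , inj₁ j) , j , refl)

  v₀ : Fin n
  v₀ = vertex-of-uncolorable M not-[k∸1]-colorable

  agree-at-v₀⇒agree : ∀ f g → InB f → InB g → (∀ j → colorAt f v₀ j ≡ colorAt g v₀ j) →
    ∀ i j → colorAt f i j ≡ colorAt g i j
  agree-at-v₀⇒agree f g (f-col , f-bad) (g-col , g-bad) agree-at-v₀ i j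
    with colorAt f i j ∈? forbidden g i
  ... | yes y∈Fg with ∈-tabulate⁻ y∈Fg
  ...   | j′ , y≡ with j Fin.≟ j′
  ...     | yes refl = y≡
  ...     | no j≢j′ = ⊥-elim (disjoint i j j′ j≢j′ _ (colorAt∈L f f-col i j)
                                (subst (_∈ L (i , inj₁ j′)) (sym y≡) (colorAt∈L g g-col i j′)))
  agree-at-v₀⇒agree f g (f-col , f-bad) (g-col , g-bad) agree-at-v₀ i j | no y∉Fg =
    ⊥-elim (proj₂ (∈-filter⁻ (_∉? forbidden f i) {xs = Lw i} y∈Rf[i]) (∈-tabulate⁺ j))
    where
    y∈Rg[i] : colorAt f i j ∈ residual g i
    y∈Rg[i] = ∈-filter⁺ (_∉? forbidden g i) (bad⇒colorAt∈Lw f f-bad i j) y∉Fg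
    Rg[v₀]≡Rf[v₀] : residual g v₀ ≡ residual f v₀
    Rg[v₀]≡Rf[v₀] = cong (λ F → filter (_∉? F) (Lw v₀)) (tabulate-cong (sym ∘ agree-at-v₀))
    y∈Rf[i] : colorAt f i j ∈ residual f i
    y∈Rf[i] = proj₁ (bad⇒residual-constant f f-bad v₀ i _)
                (subst (_ ∈_) Rg[v₀]≡Rf[v₀] (proj₁ (bad⇒residual-constant g g-bad i v₀ _) y∈Rg[i]))

  agree-at-v₀? : ∀ f g j → Dec (colorAt f v₀ j ≡ colorAt g v₀ j)
  agree-at-v₀? f g j = colorAt f v₀ j ℕ.≟ colorAt g v₀ j

  differ⇒differ-at-v₀ : ∀ f g → InB f → InB g → Differ f g → Distinct (colorAt f v₀) (colorAt g v₀)
  differ⇒differ-at-v₀ f g f∈B g∈B (((i , _) , j , refl) , f≢g) with Fin.all? (agree-at-v₀? f g)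
  ... | yes agree = ⊥-elim (f≢g (agree-at-v₀⇒agree f g f∈B g∈B agree i j))
  ... | no ¬agree = Fin.¬∀⟶∃¬ a _ (agree-at-v₀? f g) ¬agree

  candidates : Fin a → List Color
  candidates j = filter (_∈? L (v₀ , inj₁ j)) (Lw v₀)

  InB⇒candidates : ∀ f → InB f → ∀ j → colorAt f v₀ j ∈ candidates j
  InB⇒candidates f (f-col , f-bad) j = ∈-filter⁺ _ (bad⇒colorAt∈Lw f f-bad v₀ j) (colorAt∈L f f-col v₀ j)

  ∑-candidates : sum (λ j → length (candidates j)) ≤ k ∸ 1 + a
  ∑-candidates = subst (sum (λ j → length (candidates j)) ≤_) (length-Lw v₀)
    (∑-length-filter-disjoint (λ j → _∈? L (v₀ , inj₁ j)) same-list (Lw v₀))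
    where
    same-list : ∀ {j j′ x} → x ∈ L (v₀ , inj₁ j) → x ∈ L (v₀ , inj₁ j′) → j ≡ j′
    same-list {j} {j′} {x} x∈Lj x∈Lj′ with j Fin.≟ j′
    ... | yes j≡j′ = j≡j′
    ... | no j≢j′ = ⊥-elim (disjoint v₀ j j′ j≢j′ x x∈Lj x∈Lj′)

  cardBadAtMost : CardBadAtMost a M L (2 ^ (k ∸ 1))
  cardBadAtMost [] _ _ = z≤n
  cardBadAtMost fs@(f ∷ _) B@(f∈B ∷ _) distinct = begin
    length fs                        ≡⟨ length-map at-v₀ fs ⟨
    length (map at-v₀ fs)
      ≤⟨ length≤∏ ℕ._≟_ candidates _ tuples∈candidates (AllPairs.map⁺ tuples-distinct) ⟩
    ∏ (λ j → length (candidates j))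
      ≤⟨ ∑≤s+a⇒∏≤2^s _ (λ j → ∈⇒1≤length (InB⇒candidates f f∈B j)) ∑-candidates ⟩
    2 ^ (k ∸ 1)                      ∎
    where
    open ≤-Reasoning
    at-v₀ : Coloring → Fin a → Color
    at-v₀ g = colorAt g v₀
    tuples∈candidates = All.map⁺ (All.map (λ {g} → InB⇒candidates g) B)
    tuples-distinct = AllPairs.zipWith (λ ((g∈B , h∈B) , g≠h) → differ⇒differ-at-v₀ _ _ g∈B h∈B g≠h)
                                       (all⇒allPairs _,_ B , distinct)

lemma3p5 : (a k n : ℕ) → 2 ≤ k → k < a + 1 →
    (M : Graph (Fin n)) → StrongChromaticChoosable M k →
    (L : ListAssignment (Fin n × (Fin a ⊎ ⊤))) → IsKAssignment (k + a ∸ 1) L →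
    (∀ (i : Fin n) (j j' : Fin a) → j ≢ j' → ∀ (x : Color) →
       x ∈ L (i , inj₁ j) → x ∉ L (i , inj₁ j')) →
    CardBadAtMost a M L (2 ^ (k ∸ 1))
lemma3p5 a k n 2≤k _ M scc L L-size disjoint = BadColorings.cardBadAtMost a k n 2≤k M scc L L-size disjoint
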